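{- Let $G=(V,E)$ be a connected Eulerian digraph and $s\in V$, and consider the chip-firing game on $G$ with sink $s$. If $c$ is a recurrent configuration, then for every firing graph $\mathcal{F}=(V,\mathcal{E})$ of $c$: $s$ is the unique vertex of in-degree $0$ in $\mathcal{F}$, $\mathcal{E}$ is an acyclic arc set of $G$, $\mathcal{F}$ is connected, and $c(v)\ge\mathrm{outdeg}_G(v)-\mathrm{indeg}_{\mathcal{F}}(v)$ for every $v\in V\setminus\{s\}$.
   Context: Digraphs are finite and simple; Eulerian means in-degree equals out-degree at every vertex. An acyclic arc set of $G$ is $A\subseteq E$ such that $(V,A)$ has no directed cycle. Chip-firing on $G$ with sink $s$ (i.e. on $G$ with all arcs of tail $s$ deleted): a configuration is a map $c:V\setminus\{s\}\to\mathbb{N}$. A vertex $v\neq s$ is active if $c(v)\ge\mathrm{outdeg}_G(v)\ge1$; firing $v$ subtracts $\mathrm{outdeg}_G(v)$ from $c(v)$ and adds one chip to each out-neighbour $w\ne s$ of $v$ (chips sent to $s$ vanish). Legal firing = firing an active vertex; $c\to^*d$ means reachable by legal firings; $c$ stable if no vertex is active; $c^\circ$ denotes the unique stable configuration reached from $c$. $c$ is accessible if for every configuration $d$ there is $d'$ with $d+d'\to^*c$; recurrent if stable and accessible. Let $\beta(v)=1$ if $(s,v)\in E$ and $0$ otherwise. It is known that if $c$ is recurrent then $(c+\beta)^\circ=c$ and every legal firing sequence from $c+\beta$ to $c$ fires each vertex of $V\setminus\{s\}$ exactly once. A firing graph of a recurrent $c$: for a legal firing sequence $(w_1,\dots,w_k)$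 from $c+\beta$ ending at $c$, the digraph with vertex set $V$ and arc set $\{(s,w_i):(s,w_i)\in E\}\cup\{(w_i,w_j):i<j,(w_i,w_j)\in E\}$. -}

module Defs where

open import Data.Nat using (ℕ; zero; suc; _+_; _∸_; _≤_)
open import Data.Bool using (Bool; true; false; if_then_else_; T; _∧_; _∨_)
open import Data.Fin using (Fin; _≟_)
open import Data.List using (List; []; _∷_; map; allFin)
open import Data.Nat.ListAction using (sum)
open import Data.Product using (_×_; Σ; ∃)
open import Data.Sum using (_⊎_)
open import Data.Empty using (⊥)
open import Relation.Nullary using (¬_)
open import Relation.Nullary.Decidable using (⌊_⌋)
open import Relation.Binary.PropositionalEquality using (_≡_; _≢_)
open import Relation.Binary.Construct.Closure.ReflexiveTransitive using (Star)
open import Relation.Binary.Construct.Closure.Transitive using (TransClosure)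

Arcs : ℕ → Set
Arcs n = Fin n → Fin n → Bool

-- A finite simple digraph: no loops; multiple arcs are impossible by
-- construction (an arc set is a set of ordered pairs).
record Digraph (n : ℕ) : Set where
  field
    arc      : Arcs n
    loopless : ∀ v → arc v v ≡ false
open Digraph public

ind : Bool → ℕ
ind true  = 1
ind false = 0

outdegA : ∀ {n} → Arcs n → Fin n → ℕ
outdegA {n} A v = sum (map (λ w → ind (A v w)) (allFin n))

indegA : ∀ {n} → Arcs n → Fin n → ℕ
indegA {n} A v = sum (map (λ u → ind (A u v)) (allFin n))

outdeg : ∀ {n} → Digraph n → Fin n → ℕ
outdeg G = outdegA (arc G)

indeg : ∀ {n} → Digraph n → Fin n → ℕ
indeg G = indegA (arc G)

Eulerian : ∀ {n} → Digraph n → Set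
Eulerian G = ∀ v → indeg G v ≡ outdeg G v

ConnectedA : ∀ {n} → Arcs n → Set
ConnectedA A = ∀ u v → Star (λ a b → T (A a b) ⊎ T (A b a)) u v

Connected : ∀ {n} → Digraph n → Set
Connected G = ConnectedA (arc G)

AcyclicArcSet : ∀ {n} → Digraph n → Arcs n → Set
AcyclicArcSet {n} G A =
  (∀ u v → T (A u v) → T (arc G u v)) ×
  (∀ v → ¬ TransClosure (λ a b → T (A a b)) v v)

-- A configuration c : V ∖ {s} → ℕ is represented by a map Fin n → ℕ
-- with c s ≡ 0 (see IsConfig); the sink never fires and its entry is
-- never changed by firing (chips sent to s vanish).

Config : ℕ → Set
Config n = Fin n → ℕ

module ChipFiring {n : ℕ} (G : Digraph n) (s : Fin n) where

  IsConfig : Config n → Set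
  IsConfig c = c s ≡ 0

  _⊕_ : Config n → Config n → Config n
  (c ⊕ d) v = c v + d v

  Active : Config n → Fin n → Set
  Active c v = (v ≢ s) × (1 ≤ outdeg G v) × (outdeg G v ≤ c v)

  Stable : Config n → Set
  Stable c = ∀ v → ¬ Active c v

  fire : Config n → Fin n → Config n
  fire c v w =
    if ⌊ w ≟ v ⌋ then c w ∸ outdeg G v
    else if ⌊ w ≟ s ⌋ then c w
    else c w + ind (arc G v w)

  data LegalSeq : Config n → List (Fin n) → Config n → Set where
    done : ∀ {c} → LegalSeq c [] c
    step : ∀ {c v ws d} → Active c v → LegalSeq (fire c v) ws d →
           LegalSeq c (v ∷ ws) d

  _→*_ : Config n → Config n → Set
  c →* d = ∃ λ ws → LegalSeq c ws d

  Accessible : Config n → Set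
  Accessible c = ∀ d → IsConfig d →
    Σ (Config n) λ d' → IsConfig d' × ((d ⊕ d') →* c)

  Recurrent : Config n → Set
  Recurrent c = IsConfig c × Stable c × Accessible c

  β : Config n
  β v = ind (arc G s v)

  _∈ᵇ_ : Fin n → List (Fin n) → Bool
  v ∈ᵇ []       = false
  v ∈ᵇ (w ∷ ws) = ⌊ v ≟ w ⌋ ∨ (v ∈ᵇ ws)

  before : Fin n → Fin n → List (Fin n) → Bool
  before u v []       = false
  before u v (w ∷ ws) = (⌊ w ≟ u ⌋ ∧ (v ∈ᵇ ws)) ∨ before u v ws

  firingArcs : List (Fin n) → Arcs n
  firingArcs ws u v =
    (⌊ u ≟ s ⌋ ∧ arc G s v ∧ (v ∈ᵇ ws)) ∨ (arc G u v ∧ before u v ws)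

module Submission where

-- Let ws be a legal firing sequence from c ⊕ β back to the recurrent c.
-- Chip conservation: after firing the list l from x to y, every non-sink w
-- has  y w + outdeg w · #w(l) = x w + Σ_u #u(l) · E u w,  and starting
-- from c ⊕ β the sink behaves as a vertex that fired first.  Hence
--  * no vertex fires twice: a second firing of v needs v to hold c v chips
--    or more (a vertex receives at most its in-degree = out-degree), which
--    contradicts the stability of c;
--  * every non-sink vertex fires: Q = {s} ∪ ws receives no arc from the
--    unfired vertices (they received nothing), so by the cut balance of
--    Eulerian digraphs Q sends no arc to them, and G is connected.
-- Thus s ∷ ws lists every vertex once, and firing-graph arcs go forward in
-- this order: this gives acyclicity and in-degree 0 at s.  When v fires, its
-- chips come from c and along firing-graph arcs: this is the degree bound,
-- and, as v is not active in c, an in-arc at every v ≠ s, hence connectivity.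

open import Defs
open import Data.Bool using (Bool; true; false; T; not; _∧_)
open import Data.Bool.Properties using (T-≡; T-∧; T-∨; ∧-distribˡ-∨)
open import Data.Fin using (Fin; zero; suc; _≟_)
open import Data.List using (List; []; _∷_; _++_; map; allFin; tabulate)
open import Data.List.Properties using (map-tabulate; ++-identityʳ; ++-assoc)
open import Data.Nat using (ℕ; zero; suc; _+_; _*_; _∸_; _≤_; _<_; z≤n; s≤s)
import Data.Nat.ListAction as List
open import Data.Nat.Properties
  using ( +-*-semiring; module ≤-Reasoning
        ; ≤-refl; ≤-reflexive; ≤-trans; ≤-pred; <-trans; <-irrefl; n≮0; 1+n≰n; n≤0⇒n≡0; n≤1⇒n≡0∨n≡1
        ; +-assoc; +-suc; +-identityʳ; +-cancelˡ-≡; +-cancelʳ-≤; +-mono-≤; +-monoʳ-≤; m≤m+n; m≤n+m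
        ; m+n≡0⇒m≡0; m+n≡0⇒n≡0; m∸n+n≡m
        ; *-comm; *-identityˡ; *-identityʳ; *-zeroʳ; *-distribʳ-+; *-monoˡ-≤; m*n≡0⇒m≡0∨n≡0 )
open import Data.Nat.Tactic.RingSolver using (solve-∀)
open import Algebra.Properties.Semiring.Sum +-*-semiring
  using (sum-syntax; ∑-distrib-+; ∑-comm; *-distribˡ-sum; sum-cong-≗; sum-replicate-zero)
open import Data.Product using (Σ-syntax; _×_; _,_; proj₁; proj₂)
open import Data.Sum using (_⊎_; inj₁; inj₂)
open import Function using (_∘_)
open import Function.Bundles using (Equivalence)
open Equivalence using (to; from)
open import Relation.Binary.Construct.Closure.ReflexiveTransitive using (Star; ε; _◅_; _◅◅_; fold; reverse)
open import Relation.Binary.Construct.Closure.Transitive using (TransClosure; [_]; _∷_)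
open import Relation.Binary.PropositionalEquality
open import Relation.Nullary using (¬_; yes; no; contradiction)
open import Relation.Nullary.Decidable using (⌊_⌋)

∑-allFin : ∀ {n} (f : Fin n → ℕ) → List.sum (map f (allFin n)) ≡ ∑[ u < n ] f u
∑-allFin f = trans (cong List.sum (map-tabulate (λ u → u) f)) (sum-tabulate f)
  where
  sum-tabulate : ∀ {n} (g : Fin n → ℕ) → List.sum (tabulate g) ≡ ∑[ u < n ] g u
  sum-tabulate {zero}  g = refl
  sum-tabulate {suc n} g = cong (g zero +_) (sum-tabulate (g ∘ suc))

∑-mono-≤ : ∀ {n} {f g : Fin n → ℕ} → (∀ u → f u ≤ g u) → ∑[ u < n ] f u ≤ ∑[ u < n ] g u
∑-mono-≤ {zero}  f≤g = z≤n
∑-mono-≤ {suc n} f≤g = +-mono-≤ (f≤g zero) (∑-mono-≤ (f≤g ∘ suc))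

∑-zero : ∀ {n} (f : Fin n → ℕ) → (∀ u → f u ≡ 0) → ∑[ u < n ] f u ≡ 0
∑-zero {n} f f≡0 = trans (sum-cong-≗ f≡0) (sum-replicate-zero n)

∑≡0⇒≡0 : ∀ {n} (f : Fin n → ℕ) → ∑[ u < n ] f u ≡ 0 → ∀ u → f u ≡ 0
∑≡0⇒≡0 f ∑f≡0 zero    = m+n≡0⇒m≡0 (f zero) ∑f≡0
∑≡0⇒≡0 f ∑f≡0 (suc u) = ∑≡0⇒≡0 (f ∘ suc) (m+n≡0⇒n≡0 (f zero) ∑f≡0) u

∑-pos : ∀ {n} (f : Fin n → ℕ) → 1 ≤ ∑[ u < n ] f u → Σ[ u ∈ Fin n ] 1 ≤ f u
∑-pos {suc n} f pos with f zero in f₀≡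
... | suc _ = zero , subst (1 ≤_) (sym f₀≡) (s≤s z≤n)
... | zero  with ∑-pos (f ∘ suc) pos
...   | u , fu-pos = suc u , fu-pos

δ : ∀ {n} → Fin n → Fin n → ℕ
δ u v = ind ⌊ u ≟ v ⌋

δ-diag : ∀ {n} (v : Fin n) → δ v v ≡ 1
δ-diag v with v ≟ v
... | yes _  = refl
... | no v≢v = contradiction refl v≢v

δ-off : ∀ {n} {u v : Fin n} → u ≢ v → δ u v ≡ 0
δ-off {u = u} {v} u≢v with u ≟ v
... | yes u≡v = contradiction u≡v u≢v
... | no  _   = refl

∑-δ : ∀ {n} (v : Fin n) (f : Fin n → ℕ) → ∑[ u < n ] (δ u v * f u) ≡ f v
∑-δ {suc n} zero    f = begin
  1 * f zero + ∑[ u < n ] (0 * f (suc u))  ≡⟨ cong (1 * f zero +_) (sum-replicate-zero n) ⟩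
  1 * f zero + 0                           ≡⟨ +-identityʳ _ ⟩
  1 * f zero                               ≡⟨ *-identityˡ _ ⟩
  f zero                                   ∎
  where open ≡-Reasoning
∑-δ {suc n} (suc v) f = trans (sum-cong-≗ (λ u → cong (_* f (suc u)) (δ-suc u v))) (∑-δ v (f ∘ suc))
  where
  δ-suc : ∀ {n} (u v : Fin n) → δ (suc u) (suc v) ≡ δ u v
  δ-suc u v with u ≟ v
  ... | yes _ = refl
  ... | no  _ = refl

ind-∧ : ∀ a {b} → T b → ind a ≤ ind (a ∧ b)
ind-∧ false _ = z≤n
ind-∧ true {true} _ = s≤s z≤n

T-not⇒¬T : ∀ {b} → T (not b) → ¬ T b
T-not⇒¬T {false} _ ()

Weights : ℕ → Set
Weights n = Fin n → Fin n → ℕ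

Balanced : ∀ {n} → Weights n → Set
Balanced {n} E = ∀ u → ∑[ w < n ] E w u ≡ ∑[ w < n ] E u w

flow : ∀ {n} → Weights n → (P Q : Fin n → Bool) → ℕ
flow {n} E P Q = ∑[ u < n ] ∑[ w < n ] (ind (P u) * ind (Q w) * E u w)

complement : ∀ {n} → (Fin n → Bool) → Fin n → Bool
complement X u = not (X u)

indicator-split : ∀ b x y → x * y ≡ x * ind b * y + x * ind (not b) * y
indicator-split true  = solve-∀
indicator-split false = solve-∀

row-split : ∀ {n} (X : Fin n → Bool) (x : ℕ) (g : Fin n → ℕ) →
            x * ∑[ w < n ] g w ≡
            ∑[ w < n ] (x * ind (X w) * g w) + ∑[ w < n ] (x * ind (complement X w) * g w)
row-split {n} X x g = begin
  x * ∑[ w < n ] g w                                  ≡⟨ *-distribˡ-sum x g ⟩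
  ∑[ w < n ] (x * g w)                                ≡⟨ sum-cong-≗ split ⟩
  ∑[ w < n ] (x * ind (X w) * g w + x * ind (complement X w) * g w)
                                                      ≡⟨ ∑-distrib-+ {n} _ _ ⟩
  ∑[ w < n ] (x * ind (X w) * g w) + ∑[ w < n ] (x * ind (complement X w) * g w) ∎
  where
  open ≡-Reasoning
  split : ∀ w → x * g w ≡ x * ind (X w) * g w + x * ind (complement X w) * g w
  split w = indicator-split (X w) x (g w)

flow-reverse : ∀ {n} (E : Weights n) (P Q : Fin n → Bool) →
               ∑[ u < n ] ∑[ w < n ] (ind (P u) * ind (Q w) * E w u) ≡ flow E Q P
flow-reverse {n} E P Q = trans (∑-comm {n} {n} _)
  (sum-cong-≗ λ w → sum-cong-≗ λ u → cong (_* E w u) (*-comm (ind (P u)) (ind (Q w))))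

cut-balance : ∀ {n} (E : Weights n) → Balanced E → (X : Fin n → Bool) →
              flow E X (complement X) ≡ flow E (complement X) X
cut-balance {n} E balanced X =
  +-cancelˡ-≡ (flow E X X) _ _ (trans (sym out-weight) in-weight)
  where
  open ≡-Reasoning
  χ : Fin n → ℕ
  χ u = ind (X u)
  out-weight : ∑[ u < n ] (χ u * ∑[ w < n ] E u w) ≡ flow E X X + flow E X (complement X)
  out-weight = trans (sum-cong-≗ λ u → row-split X (χ u) (E u)) (∑-distrib-+ {n} _ _)
  in-weight : ∑[ u < n ] (χ u * ∑[ w < n ] E u w) ≡ flow E X X + flow E (complement X) X
  in-weight = begin
    ∑[ u < n ] (χ u * ∑[ w < n ] E u w)   ≡⟨ sum-cong-≗ (λ u → cong (χ u *_) (sym (balanced u))) ⟩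
    ∑[ u < n ] (χ u * ∑[ w < n ] E w u)   ≡⟨ sum-cong-≗ (λ u → row-split X (χ u) (λ w → E w u)) ⟩
    ∑[ u < n ] (∑[ w < n ] (χ u * χ w * E w u) + ∑[ w < n ] (χ u * ind (complement X w) * E w u))
                                          ≡⟨ ∑-distrib-+ {n} _ _ ⟩
    ∑[ u < n ] ∑[ w < n ] (χ u * χ w * E w u) + ∑[ u < n ] ∑[ w < n ] (χ u * ind (complement X w) * E w u)
                                          ≡⟨ cong₂ _+_ (flow-reverse E X X) (flow-reverse E X (complement X)) ⟩
    flow E X X + flow E (complement X) X  ∎

flow≡0 : ∀ {n} (E : Weights n) (P Q : Fin n → Bool) →
         (∀ u w → T (P u) → T (Q w) → E u w ≡ 0) → flow E P Q ≡ 0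
flow≡0 E P Q no-arc = ∑-zero _ λ u → ∑-zero _ λ w → term u w
  where
  term : ∀ u w → ind (P u) * ind (Q w) * E u w ≡ 0
  term u w with P u in Pu | Q w in Qw
  ... | false | _     = refl
  ... | true  | false = refl
  ... | true  | true  = trans (+-identityʳ _) (no-arc u w (T-≡ .from Pu) (T-≡ .from Qw))

flow≡0⇒no-arc : ∀ {n} (E : Weights n) (P Q : Fin n → Bool) →
                flow E P Q ≡ 0 → ∀ u w → T (P u) → T (Q w) → E u w ≡ 0
flow≡0⇒no-arc E P Q flow≡0 u w Pu Qw = begin
  E u w                            ≡⟨ sym (+-identityʳ _) ⟩
  E u w + 0                        ≡⟨ cong₂ (λ p q → ind p * ind q * E u w) (sym (T-≡ .to Pu)) (sym (T-≡ .to Qw)) ⟩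
  ind (P u) * ind (Q w) * E u w    ≡⟨ ∑≡0⇒≡0 _ (∑≡0⇒≡0 _ flow≡0 u) w ⟩
  0                                ∎
  where open ≡-Reasoning

no-exit⇒no-entry : ∀ {n} (E : Weights n) → Balanced E → (X : Fin n → Bool) →
                   (∀ u w → T (X u) → T (complement X w) → E u w ≡ 0) →
                   ∀ u w → T (complement X u) → T (X w) → E u w ≡ 0
no-exit⇒no-entry E balanced X no-exit =
  flow≡0⇒no-arc E (complement X) X
    (trans (sym (cut-balance E balanced X)) (flow≡0 E X (complement X) no-exit))

in-neighbour : ∀ {n} (A : Arcs n) v → 1 ≤ indegA A v → Σ[ u ∈ Fin n ] T (A u v)
in-neighbour {n} A v pos with ∑-pos (λ u → ind (A u v)) (subst (1 ≤_) (∑-allFin {n} _) pos)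
... | u , Auv-pos = u , ind-pos Auv-pos
  where
  ind-pos : ∀ {b} → 1 ≤ ind b → T b
  ind-pos {true} _ = _

no-in-neighbour : ∀ {n} (A : Arcs n) v → (∀ u → ¬ T (A u v)) → indegA A v ≡ 0
no-in-neighbour {n} A v none = trans (∑-allFin {n} _) (∑-zero _ λ u → ind-false (none u))
  where
  ind-false : ∀ {b} → ¬ T b → ind b ≡ 0
  ind-false {false} _   = refl
  ind-false {true}  ¬tt = contradiction _ ¬tt

constant-on-connected : ∀ {n} (A : Arcs n) → ConnectedA A → (X : Fin n → Bool) →
                        (∀ u w → T (A u w) → X u ≡ X w) → ∀ a b → X a ≡ X b
constant-on-connected A connected X agree a b =
  fold (λ a b → X a ≡ X b) (λ adj Xb≡Xc → trans (along adj) Xb≡Xc) refl (connected a b)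
  where
  along : ∀ {u w} → T (A u w) ⊎ T (A w u) → X u ≡ X w
  along {u} {w} (inj₁ Auw) = agree u w Auw
  along {u} {w} (inj₂ Awu) = sym (agree w u Awu)

module Ranked {n : ℕ} (A : Arcs n) (rank : Fin n → ℕ)
              (ascending : ∀ {u w} → T (A u w) → rank u < rank w) where

  ascending⁺ : ∀ {u w} → TransClosure (λ a b → T (A a b)) u w → rank u < rank w
  ascending⁺ [ Auw ]      = ascending Auw
  ascending⁺ (Auv ∷ path) = <-trans (ascending Auv) (ascending⁺ path)

  acyclic : ∀ v → ¬ TransClosure (λ a b → T (A a b)) v v
  acyclic v cycle = <-irrefl refl (ascending⁺ cycle)

  -- If every vertex other than the root has an in-neighbour, then every
  -- vertex is reached from the root by following in-neighbours down the
  -- rank, so the arc set is connected.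
  rooted⇒connected : (root : Fin n) → (∀ v → v ≢ root → Σ[ u ∈ Fin n ] T (A u v)) →
                     ConnectedA A
  rooted⇒connected root has-parent a b =
    reverse flip (from-root a (suc (rank a)) (s≤s ≤-refl)) ◅◅ from-root b (suc (rank b)) (s≤s ≤-refl)
    where
    Adjacent : Fin n → Fin n → Set
    Adjacent u w = T (A u w) ⊎ T (A w u)
    flip : ∀ {u w} → Adjacent u w → Adjacent w u
    flip (inj₁ Auw) = inj₂ Auw
    flip (inj₂ Awu) = inj₁ Awu
    from-root : ∀ v bound → rank v < bound → Star Adjacent root v
    from-root v (suc bound) (s≤s rank≤) with v ≟ root
    ... | yes refl = ε
    ... | no v≢root with has-parent v v≢root
    ...   | u , Auv = from-root u bound (≤-trans (ascending Auv) rank≤) ◅◅ (inj₁ Auv ◅ ε)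

module Sequences {n : ℕ} (G : Digraph n) (s : Fin n) where
  open ChipFiring G s using (_∈ᵇ_; before)

  occ : Fin n → List (Fin n) → ℕ
  occ v []      = 0
  occ v (w ∷ l) = δ v w + occ v l

  Distinct : List (Fin n) → Set
  Distinct l = ∀ v → occ v l ≤ 1

  occ-++ : ∀ v l m → occ v (l ++ m) ≡ occ v l + occ v m
  occ-++ v []      m = refl
  occ-++ v (w ∷ l) m = trans (cong (δ v w +_) (occ-++ v l m)) (sym (+-assoc (δ v w) _ _))

  ∈⇒occ-pos : ∀ {v} l → T (v ∈ᵇ l) → 1 ≤ occ v l
  ∈⇒occ-pos {v} (w ∷ l) v∈ with v ≟ w
  ... | yes _ = s≤s z≤n
  ... | no  _ = ∈⇒occ-pos l v∈

  ∉⇒occ≡0 : ∀ {v} l → ¬ T (v ∈ᵇ l) → occ v l ≡ 0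
  ∉⇒occ≡0     []      v∉ = refl
  ∉⇒occ≡0 {v} (w ∷ l) v∉ with v ≟ w
  ... | yes _ = contradiction _ v∉
  ... | no  _ = ∉⇒occ≡0 l v∉

  ∈-middle : ∀ v pre rest → T (v ∈ᵇ (pre ++ v ∷ rest))
  ∈-middle v []      rest with v ≟ v
  ... | yes _  = _
  ... | no v≢v = contradiction refl v≢v
  ∈-middle v (w ∷ pre) rest with v ≟ w
  ... | yes _ = _
  ... | no  _ = ∈-middle v pre rest

  ∈-split : ∀ {v} l → T (v ∈ᵇ l) → Σ[ pre ∈ List (Fin n) ] Σ[ rest ∈ List (Fin n) ] l ≡ pre ++ v ∷ rest
  ∈-split {v} (w ∷ l) v∈ with v ≟ w
  ... | yes refl = [] , l , refl
  ... | no  _ with ∈-split l v∈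
  ...   | pre , rest , refl = w ∷ pre , rest , refl

  occ-middle : ∀ v pre rest → occ v (pre ++ v ∷ rest) ≡ occ v pre + suc (occ v rest)
  occ-middle v pre rest = trans (occ-++ v pre (v ∷ rest)) (cong (λ k → occ v pre + (k + occ v rest)) (δ-diag v))

  ∈-cons-other : ∀ {v w l} → v ≢ w → T (v ∈ᵇ (w ∷ l)) → T (v ∈ᵇ l)
  ∈-cons-other {v} {w} v≢w v∈ with v ≟ w
  ... | yes v≡w = contradiction v≡w v≢w
  ... | no  _   = v∈

  unfired : ∀ {v w l} → ¬ T (v ∈ᵇ (w ∷ l)) → v ≢ w × occ v l ≡ 0
  unfired {v} {w} {l} v∉ with v ≟ w
  ... | yes _   = contradiction _ v∉
  ... | no v≢w = v≢w , ∉⇒occ≡0 l v∉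

  distinct-tail : ∀ {w l} → Distinct (w ∷ l) → Distinct l
  distinct-tail {w} {l} distinct v = ≤-trans (m≤n+m (occ v l) (δ v w)) (distinct v)

  distinct-head : ∀ {w l} → Distinct (w ∷ l) → ¬ T (w ∈ᵇ l)
  distinct-head {w} {l} distinct w∈l =
    1+n≰n (≤-trans (+-mono-≤ (≤-reflexive (sym (δ-diag w))) (∈⇒occ-pos l w∈l)) (distinct w))

  distinct-prefix : ∀ pre {v} rest → Distinct (pre ++ v ∷ rest) → Distinct pre × occ v pre ≡ 0
  distinct-prefix pre {v} rest distinct = prefix-distinct , v∉pre
    where
    prefix-distinct : Distinct pre
    prefix-distinct u = ≤-trans (subst (occ u pre ≤_) (sym (occ-++ u pre (v ∷ rest))) (m≤m+n _ _)) (distinct u)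
    v∉pre : occ v pre ≡ 0
    v∉pre = m+n≡0⇒m≡0 _ (n≤0⇒n≡0 (≤-pred (subst (_≤ 1) (trans (occ-middle v pre rest) (+-suc _ _)) (distinct v))))

  distinct-snoc : ∀ {l v} → Distinct l → occ v l ≡ 0 → Distinct (l ++ v ∷ [])
  distinct-snoc {l} {v} distinct v∉l u with u ≟ v
  ... | yes refl = ≤-reflexive (trans (occ-++ u l (u ∷ [])) (cong₂ _+_ v∉l (cong (_+ 0) (δ-diag u))))
  ... | no u≢v   = subst (_≤ 1) (sym occ-unchanged) (distinct u)
    where
    occ-unchanged : occ u (l ++ v ∷ []) ≡ occ u l
    occ-unchanged = trans (occ-++ u l (v ∷ [])) (trans (cong (λ k → occ u l + (k + 0)) (δ-off u≢v)) (+-identityʳ _))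

  before-∈-tail : ∀ {u v w} l → T (before u v (w ∷ l)) → T (v ∈ᵇ l)
  before-∈-tail {u} {v} {w} l u<v with T-∨ {⌊ w ≟ u ⌋ ∧ (v ∈ᵇ l)} .to u<v
  ... | inj₁ w≡u∧v∈l = proj₂ (T-∧ {⌊ w ≟ u ⌋} .to w≡u∧v∈l)
  before-∈-tail {u} {v} {w} (x ∷ l) u<v | inj₂ u<v-in-tail =
    T-∨ {⌊ v ≟ x ⌋} .from (inj₂ (before-∈-tail l u<v-in-tail))

  before-tail : ∀ {u v w} l → u ≢ w → T (before u v (w ∷ l)) → T (before u v l)
  before-tail {u} {v} {w} l u≢w u<v with w ≟ u
  ... | yes refl = contradiction refl u≢w
  ... | no  _    = u<v

  before-middle : ∀ {u} v pre rest → T (u ∈ᵇ pre) → T (before u v (pre ++ v ∷ rest))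
  before-middle {u} v (w ∷ pre) rest u∈ with u ≟ w | w ≟ u
  ... | yes refl | yes _    = T-∨ {v ∈ᵇ (pre ++ v ∷ rest)} .from (inj₁ (∈-middle v pre rest))
  ... | yes refl | no u≢u   = contradiction refl u≢u
  ... | no u≢w   | yes refl = contradiction refl u≢w
  ... | no _     | no _     = before-middle v pre rest u∈

  position : Fin n → List (Fin n) → ℕ
  position v []      = 0
  position v (w ∷ l) with v ≟ w
  ... | yes _ = 0
  ... | no  _ = suc (position v l)

  position-head : ∀ v l → position v (v ∷ l) ≡ 0
  position-head v l with v ≟ v
  ... | yes _  = refl
  ... | no v≢v = contradiction refl v≢v

  before⇒position< : ∀ {u v} l → Distinct l → T (before u v l) → position u l < position v l
  before⇒position< {u} {v} (w ∷ l) distinct u<v with u ≟ w | v ≟ w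
  ... | _        | yes refl = contradiction (before-∈-tail l u<v) (distinct-head {w} {l} distinct)
  ... | yes refl | no  _    = s≤s z≤n
  ... | no u≢w   | no  _    = s≤s (before⇒position< l (distinct-tail {w} {l} distinct) (before-tail l u≢w u<v))

module Firing {n : ℕ} (G : Digraph n) (s : Fin n) where
  open ChipFiring G s
  open Sequences G s

  E : Weights n
  E u w = ind (arc G u w)

  arc⇒E≢0 : ∀ {u w} → T (arc G u w) → E u w ≢ 0
  arc⇒E≢0 Auw Euw≡0 = contradiction (trans (sym (cong ind (T-≡ .to Auw))) Euw≡0) λ ()

  inflow : List (Fin n) → Fin n → ℕ
  inflow l w = ∑[ u < n ] (occ u l * E u w)

  inflow-∷ : ∀ v l w → inflow (v ∷ l) w ≡ E v w + inflow l w
  inflow-∷ v l w = begin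
    ∑[ u < n ] ((δ u v + occ u l) * E u w)                   ≡⟨ sum-cong-≗ (λ u → *-distribʳ-+ (E u w) (δ u v) (occ u l)) ⟩
    ∑[ u < n ] (δ u v * E u w + occ u l * E u w)             ≡⟨ ∑-distrib-+ {n} _ _ ⟩
    ∑[ u < n ] (δ u v * E u w) + inflow l w                  ≡⟨ cong (_+ inflow l w) (∑-δ v (λ u → E u w)) ⟩
    E v w + inflow l w                                       ∎
    where open ≡-Reasoning

  -- One legal firing of v: v loses its out-degree (exactly, as it is
  -- active; G has no loops) and every other non-sink w gains E v w.
  fire-balance : ∀ x v w → outdeg G v ≤ x v → w ≢ s →
                 fire x v w + outdeg G w * δ w v ≡ x w + E v w
  fire-balance x v w o≤x w≢s with w ≟ v
  ... | yes refl = begin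
    (x w ∸ outdeg G w) + outdeg G w * 1  ≡⟨ cong (x w ∸ outdeg G w +_) (*-identityʳ _) ⟩
    (x w ∸ outdeg G w) + outdeg G w      ≡⟨ m∸n+n≡m o≤x ⟩
    x w                                  ≡⟨ sym (+-identityʳ _) ⟩
    x w + 0                              ≡⟨ cong (λ b → x w + ind b) (sym (loopless G w)) ⟩
    x w + E w w                          ∎
    where open ≡-Reasoning
  ... | no _ with w ≟ s
  ...   | yes w≡s = contradiction w≡s w≢s
  ...   | no  _   = trans (cong (x w + E v w +_) (*-zeroʳ (outdeg G w))) (+-identityʳ _)

  conservation : ∀ {x l y} → LegalSeq x l y → ∀ w → w ≢ s →
                 y w + outdeg G w * occ w l ≡ x w + inflow l w
  conservation {x} done w w≢s = begin
    x w + outdeg G w * 0        ≡⟨ cong (x w +_) (*-zeroʳ (outdeg G w)) ⟩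
    x w + 0                     ≡⟨ cong (x w +_) (sym (∑-zero {n} _ (λ u → refl))) ⟩
    x w + inflow [] w           ∎
    where open ≡-Reasoning
  conservation {x} {v ∷ l} {y} (step (_ , _ , o≤x) rest) w w≢s = begin
    y w + o w * (δ w v + occ w l)             ≡⟨ spend-split (y w) (o w) (δ w v) (occ w l) ⟩
    (y w + o w * occ w l) + o w * δ w v       ≡⟨ cong (_+ o w * δ w v) (conservation rest w w≢s) ⟩
    (fire x v w + inflow l w) + o w * δ w v   ≡⟨ swap-last (fire x v w) (inflow l w) (o w * δ w v) ⟩
    (fire x v w + o w * δ w v) + inflow l w   ≡⟨ cong (_+ inflow l w) (fire-balance x v w o≤x w≢s) ⟩
    (x w + E v w) + inflow l w                ≡⟨ +-assoc (x w) (E v w) (inflow l w) ⟩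
    x w + (E v w + inflow l w)                ≡⟨ cong (x w +_) (sym (inflow-∷ v l w)) ⟩
    x w + inflow (v ∷ l) w                    ∎
    where
    open ≡-Reasoning
    o : Fin n → ℕ
    o = outdeg G
    spend-split : ∀ a b c d → a + b * (c + d) ≡ (a + b * d) + b * c
    spend-split = solve-∀
    swap-last : ∀ a b c → (a + b) + c ≡ (a + c) + b
    swap-last = solve-∀

  -- Starting from c ⊕ β, the sink behaves as a vertex that fired first.
  conservation-from-β : ∀ c {l y} → LegalSeq (c ⊕ β) l y → ∀ w → w ≢ s →
                        y w + outdeg G w * occ w l ≡ c w + inflow (s ∷ l) w
  conservation-from-β c {l} seq w w≢s =
    trans (conservation seq w w≢s)
          (trans (+-assoc (c w) (E s w) (inflow l w)) (cong (c w +_) (sym (inflow-∷ s l w))))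

  legal-snoc : ∀ {x l y v} → LegalSeq x l y → Active y v → LegalSeq x (l ++ v ∷ []) (fire y v)
  legal-snoc done         v-active = step v-active done
  legal-snoc (step a seq) v-active = step a (legal-snoc seq v-active)

  legal-prefix : ∀ {x y} pre {v} rest → LegalSeq x (pre ++ v ∷ rest) y →
                 Σ[ z ∈ Config n ] LegalSeq x pre z × Active z v
  legal-prefix {x} []        rest (step v-active _) = x , done , v-active
  legal-prefix     (w ∷ pre) rest (step w-active seq) with legal-prefix pre rest seq
  ... | z , seq-pre , v-active = z , step w-active seq-pre , v-active

  no-arc-from : ∀ {l u w} → inflow l w ≡ 0 → T (u ∈ᵇ l) → E u w ≡ 0
  no-arc-from {l} {u} {w} nothing u∈l with m*n≡0⇒m≡0∨n≡0 (occ u l) (∑≡0⇒≡0 _ nothing u)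
  ... | inj₁ u∉l  = contradiction (subst (1 ≤_) u∉l (∈⇒occ-pos l u∈l)) λ ()
  ... | inj₂ Euw≡0 = Euw≡0

  -- A duplicate-free list of firings sends at most one chip along each arc,
  -- so its inflow at w is at most any bound on the arcs from the list to w.
  inflow-bound : ∀ {l} w (f : Fin n → ℕ) → Distinct l → (∀ u → T (u ∈ᵇ l) → E u w ≤ f u) →
                 inflow l w ≤ ∑[ u < n ] f u
  inflow-bound {l} w f distinct arc≤f = ∑-mono-≤ term
    where
    term : ∀ u → occ u l * E u w ≤ f u
    term u with u ∈ᵇ l in u∈?
    ... | true  = ≤-trans (*-monoˡ-≤ (E u w) (distinct u))
                          (subst (_≤ f u) (sym (+-identityʳ _)) (arc≤f u (T-≡ .from u∈?)))
    ... | false = subst (λ k → k * E u w ≤ f u) (sym (∉⇒occ≡0 l (λ u∈l → subst T u∈? u∈l))) z≤n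

module FiringGraph {n : ℕ} (G : Digraph n) (s : Fin n) where
  open ChipFiring G s
  open Sequences G s
  open Firing G s

  firingArcs-before : ∀ ws u v → firingArcs ws u v ≡ arc G u v ∧ before u v (s ∷ ws)
  firingArcs-before ws u v with u ≟ s | s ≟ u
  ... | yes refl | yes _    = sym (∧-distribˡ-∨ (arc G u v) _ _)
  ... | yes refl | no s≢s   = contradiction refl s≢s
  ... | no u≢s   | yes refl = contradiction refl u≢s
  ... | no _     | no _     = refl

  firing-arc⇒arc : ∀ ws {u v} → T (firingArcs ws u v) → T (arc G u v)
  firing-arc⇒arc ws {u} {v} Fuv = proj₁ (T-∧ .to (subst T (firingArcs-before ws u v) Fuv))

  firing-arc⇒before : ∀ ws {u v} → T (firingArcs ws u v) → T (before u v (s ∷ ws))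
  firing-arc⇒before ws {u} {v} Fuv = proj₂ (T-∧ {arc G u v} .to (subst T (firingArcs-before ws u v) Fuv))

  -- When v fires after the prefix pre it is active, and all its chips come
  -- from c and along the firing-graph arcs into v.
  firing-condition : ∀ c pre v rest {y} → LegalSeq (c ⊕ β) (pre ++ v ∷ rest) y →
                     Distinct (s ∷ pre ++ v ∷ rest) →
                     1 ≤ outdeg G v × outdeg G v ≤ c v + indegA (firingArcs (pre ++ v ∷ rest)) v
  firing-condition c pre v rest seq distinct
    with legal-prefix pre rest seq | distinct-prefix (s ∷ pre) rest distinct
  ... | x , seq-pre , (v≢s , o-pos , o≤x) | distinct-pre , v-fresh = o-pos , (begin
    outdeg G v                ≤⟨ o≤x ⟩
    x v                       ≡⟨ chips-at-v ⟩
    c v + inflow (s ∷ pre) v  ≤⟨ +-monoʳ-≤ (c v) received-along-F ⟩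
    c v + indegA F v          ∎)
    where
    open ≤-Reasoning
    F : Arcs n
    F = firingArcs (pre ++ v ∷ rest)
    chips-at-v : x v ≡ c v + inflow (s ∷ pre) v
    chips-at-v = trans (sym not-spent) (conservation-from-β c seq-pre v v≢s)
      where
      not-spent : x v + outdeg G v * occ v pre ≡ x v
      not-spent = trans (cong (λ k → x v + outdeg G v * k) (m+n≡0⇒n≡0 (δ v s) v-fresh))
                        (trans (cong (x v +_) (*-zeroʳ (outdeg G v))) (+-identityʳ (x v)))
    arc-in-F : ∀ u → T (u ∈ᵇ (s ∷ pre)) → E u v ≤ ind (F u v)
    arc-in-F u u∈ = subst (λ b → E u v ≤ ind b) (sym (firingArcs-before (pre ++ v ∷ rest) u v))
                          (ind-∧ (arc G u v) (before-middle v (s ∷ pre) rest u∈))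
    received-along-F : inflow (s ∷ pre) v ≤ indegA F v
    received-along-F = subst (inflow (s ∷ pre) v ≤_) (sym (∑-allFin {n} _))
                             (inflow-bound {s ∷ pre} v (λ u → ind (F u v)) distinct-pre arc-in-F)

module Recurrence {n : ℕ} (G : Digraph n) (s : Fin n) (eulerian : Eulerian G) (c : Config n) where
  open ChipFiring G s
  open Sequences G s
  open Firing G s
  open FiringGraph G s

  balanced : Balanced E
  balanced u = trans (sym (∑-allFin {n} _)) (trans (eulerian u) (∑-allFin {n} _))

  -- If every vertex fires at most once, and the sink is counted as having
  -- fired, then a vertex receives at most its in-degree, i.e. its out-degree.
  received≤outdeg : ∀ {l} w → Distinct (s ∷ l) → inflow (s ∷ l) w ≤ outdeg G w
  received≤outdeg {l} w distinct =
    subst (inflow (s ∷ l) w ≤_) (trans (sym (∑-allFin {n} _)) (eulerian w))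
          (inflow-bound {s ∷ l} w (λ u → E u w) distinct (λ _ _ → ≤-refl))

  received-nothing : ∀ {ws w} → LegalSeq (c ⊕ β) ws c → w ≢ s → occ w ws ≡ 0 → inflow (s ∷ ws) w ≡ 0
  received-nothing {ws} {w} seq w≢s w∉ws =
    sym (+-cancelˡ-≡ (c w) 0 _ (trans (sym spent-nothing) (conservation-from-β c seq w w≢s)))
    where
    spent-nothing : c w + outdeg G w * occ w ws ≡ c w + 0
    spent-nothing = trans (cong (λ k → c w + outdeg G w * k) w∉ws) (cong (c w +_) (*-zeroʳ (outdeg G w)))

  -- A legal sequence from c ⊕ β back to c fires every non-sink vertex:
  -- the vertices that fired (with s) receive no arc from the others, so by
  -- balance send none to them, and connectivity leaves no other vertex.
  fires-everywhere : Connected G → ∀ {ws} → LegalSeq (c ⊕ β) ws c → ∀ v → v ≢ s → T (v ∈ᵇ ws)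
  fires-everywhere connected {ws} seq v v≢s =
    ∈-cons-other {l = ws} v≢s (subst T (constant-on-connected (arc G) connected fired agree s v) (∈-middle s [] ws))
    where
    fired : Fin n → Bool
    fired u = u ∈ᵇ (s ∷ ws)

    no-exit : ∀ u w → T (fired u) → T (complement fired w) → E u w ≡ 0
    no-exit u w u-fired w-unfired with unfired {l = ws} (T-not⇒¬T w-unfired)
    ... | w≢s , w∉ws = no-arc-from {s ∷ ws} (received-nothing seq w≢s w∉ws) u-fired

    no-entry : ∀ u w → T (complement fired u) → T (fired w) → E u w ≡ 0
    no-entry = no-exit⇒no-entry E balanced fired no-exit

    agree : ∀ u w → T (arc G u w) → fired u ≡ fired w
    agree u w Auw with fired u in fu | fired w in fw
    ... | true  | true  = refl
    ... | false | false = refl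
    ... | true  | false = contradiction (no-exit u w (T-≡ .from fu) (subst (T ∘ not) (sym fw) _)) (arc⇒E≢0 Auw)
    ... | false | true  = contradiction (no-entry u w (subst (T ∘ not) (sym fu) _) (T-≡ .from fw)) (arc⇒E≢0 Auw)

  -- On a stable c no vertex fires twice in a legal sequence from c ⊕ β:
  -- a second firing of v would need v to hold at least c v ≥ outdeg v chips.
  module _ (stable : Stable c) where

    not-yet-fired : ∀ {pre x v} → LegalSeq (c ⊕ β) pre x → Distinct (s ∷ pre) → Active x v →
                    occ v pre ≡ 0
    not-yet-fired {pre} {x} {v} seq distinct (v≢s , o-pos , o≤x)
      with n≤1⇒n≡0∨n≡1 (distinct-tail {s} {pre} distinct v)
    ... | inj₁ never = never
    ... | inj₂ once  = contradiction (v≢s , o-pos , ≤-trans o≤x x≤c) (stable v)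
      where
      open ≤-Reasoning
      x≤c : x v ≤ c v
      x≤c = +-cancelʳ-≤ (outdeg G v) (x v) (c v) (begin
        x v + outdeg G v              ≡⟨ cong (x v +_) (sym (trans (cong (outdeg G v *_) once) (*-identityʳ _))) ⟩
        x v + outdeg G v * occ v pre  ≡⟨ conservation-from-β c seq v v≢s ⟩
        c v + inflow (s ∷ pre) v      ≤⟨ +-monoʳ-≤ (c v) (received≤outdeg {pre} v distinct) ⟩
        c v + outdeg G v              ∎)

    fires-at-most-once : ∀ {l y} → LegalSeq (c ⊕ β) l y → Distinct (s ∷ l)
    fires-at-most-once = extend done (distinct-snoc {[]} (λ _ → z≤n) refl)
      where
      extend : ∀ {pre x rest y} → LegalSeq (c ⊕ β) pre x → Distinct (s ∷ pre) →
               LegalSeq x rest y → Distinct (s ∷ pre ++ rest)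
      extend {pre} _   distinct done =
        subst (λ l → Distinct (s ∷ l)) (sym (++-identityʳ pre)) distinct
      extend {pre} seq distinct (step {v = v} {ws = rest} v-active seq-rest) =
        subst (λ l → Distinct (s ∷ l)) (++-assoc pre (v ∷ []) rest)
          (extend (legal-snoc seq v-active) (distinct-snoc {s ∷ pre} distinct v-fresh) seq-rest)
        where
        v-fresh : occ v (s ∷ pre) ≡ 0
        v-fresh = cong₂ _+_ (δ-off (proj₁ v-active)) (not-yet-fired seq distinct v-active)

    -- Every non-sink vertex fires exactly once on the way back to c, so the
    -- firing condition holds at every non-sink vertex ...
    fed-by-firing-graph : Connected G → ∀ ws → LegalSeq (c ⊕ β) ws c → ∀ v → v ≢ s →
                          1 ≤ outdeg G v × outdeg G v ≤ c v + indegA (firingArcs ws) v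
    fed-by-firing-graph connected ws seq v v≢s with ∈-split ws (fires-everywhere connected seq v v≢s)
    ... | pre , rest , refl = firing-condition c pre v rest seq (fires-at-most-once seq)

    -- ... and, v not being active in c, v has an in-arc in the firing graph.
    firing-indeg-pos : Connected G → ∀ ws → LegalSeq (c ⊕ β) ws c → ∀ v → v ≢ s →
                       1 ≤ indegA (firingArcs ws) v
    firing-indeg-pos connected ws seq v v≢s
      with indegA (firingArcs ws) v | fed-by-firing-graph connected ws seq v v≢s
    ... | suc _ | _             = s≤s z≤n
    ... | zero  | o-pos , o≤c+0 =
      contradiction (v≢s , o-pos , subst (outdeg G v ≤_) (+-identityʳ (c v)) o≤c+0) (stable v)

lemma11 : ∀ {n} (G : Digraph n) (s : Fin n) → Eulerian G → Connected G →
          (c : Config n) → ChipFiring.Recurrent G s c →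
          (ws : List (Fin n)) →
          ChipFiring.LegalSeq G s (ChipFiring._⊕_ G s c (ChipFiring.β G s)) ws c →
          (indegA (ChipFiring.firingArcs G s ws) s ≡ 0 ×
           (∀ v → indegA (ChipFiring.firingArcs G s ws) v ≡ 0 → v ≡ s)) ×
          AcyclicArcSet G (ChipFiring.firingArcs G s ws) ×
          ConnectedA (ChipFiring.firingArcs G s ws) ×
          (∀ v → v ≢ s → outdeg G v ≤ c v + indegA (ChipFiring.firingArcs G s ws) v)
lemma11 {n} G s eulerian connected c (_ , stable , _) ws seq =
  (sink-source , only-source) , ((λ u v → firing-arc⇒arc ws) , acyclic) ,
  rooted⇒connected s (λ v v≢s → in-neighbour F v (firing-indeg-pos stable connected ws seq v v≢s)) ,
  (λ v v≢s → proj₂ (fed-by-firing-graph stable connected ws seq v v≢s))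
  where
  open ChipFiring G s using (firingArcs)
  open Sequences G s
  open FiringGraph G s
  open Recurrence G s eulerian c
  F : Arcs n
  F = firingArcs ws
  -- Ranking vertices by their position in the firing order s ∷ ws, which
  -- is duplicate-free, firing-graph arcs point forward.
  rank : Fin n → ℕ
  rank v = position v (s ∷ ws)
  ascending : ∀ {u v} → T (F u v) → rank u < rank v
  ascending Fuv = before⇒position< (s ∷ ws) (fires-at-most-once stable seq) (firing-arc⇒before ws Fuv)
  open Ranked F rank ascending
  sink-source : indegA F s ≡ 0
  sink-source = no-in-neighbour F s λ u Fus → n≮0 (subst (rank u <_) (position-head s ws) (ascending Fus))
  only-source : ∀ v → indegA F v ≡ 0 → v ≡ s
  only-source v indeg≡0 with v ≟ s
  ... | yes v≡s = v≡s
  ... | no v≢s  = contradiction (subst (1 ≤_) indeg≡0 (firing-indeg-pos stable connected ws seq v v≢s)) λ ()
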